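{- For every natural number $n$ and every odd integer $r>1$, there is a colouring of $[3]^n$ with $r$ colours such that no monochromatic combinatorial line in $[3]^n$ has a wildcard set that is the union of fewer than $r$ intervals.
   Context: For natural numbers $m,n$, $[m]=\{1,\dots,m\}$ and $[m]^n$ is the set of all words of length $n$ over the alphabet $[m]$. For a word $w\in[m]^n$, a subset $S\subseteq[n]$ and $i\in[m]$, $w(S,i)$ denotes the word obtained from $w$ by replacing the $j$-th letter by $i$ for every $j\in S$. A combinatorial line in $[m]^n$ with wildcard set $S\neq\emptyset$ is a set of the form $\{w(S,1),w(S,2),\dots,w(S,m)\}$ for some word $w\in[m]^n$. An interval is a set of consecutive integers $\{a,a+1,\dots,b\}\subseteq[n]$. An $r$-colouring is a map from $[3]^n$ to a set of $r$ colours, and a line is monochromatic if all its elements receive the same colour. -}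

module Defs where

open import Data.Nat using (ℕ; _<_)
open import Data.Fin using (Fin; toℕ; zero; suc)
open import Data.Fin using () renaming (_≤_ to _≤ᶠ_)
open import Data.Bool using (Bool; true; false; if_then_else_)
open import Data.List using (List; length)
open import Data.List.Relation.Unary.All using (All)
open import Data.List.Relation.Unary.Any using (Any)
open import Data.Product using (Σ; ∃; _×_; _,_; proj₁; proj₂)
open import Relation.Binary.PropositionalEquality using (_≡_)
open import Function.Bundles using (_⇔_)

-- Words of length n over the alphabet [3]; letter i ∈ [3] is encoded as Fin 3
-- (1 ↦ 0, 2 ↦ 1, 3 ↦ 2), position j ∈ [n] as Fin n.
Word : ℕ → Set
Word n = Fin n → Fin 3

SubsetOf : ℕ → Set
SubsetOf n = Fin n → Bool

NonEmpty : {n : ℕ} → SubsetOf n → Set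
NonEmpty {n} S = ∃ λ (j : Fin n) → S j ≡ true

replace : {n : ℕ} → Word n → SubsetOf n → Fin 3 → Word n
replace w S i j = if S j then i else w j

Colouring : ℕ → ℕ → Set
Colouring r n = Word n → Fin r

MonochromaticLine : {r n : ℕ} → Colouring r n → Word n → SubsetOf n → Set
MonochromaticLine c w S =
  NonEmpty S ×
  (c (replace w S zero) ≡ c (replace w S (suc zero)) ×
   c (replace w S (suc zero)) ≡ c (replace w S (suc (suc zero))))

Interval : ℕ → Set
Interval n = Σ (Fin n × Fin n) λ ab → proj₁ ab ≤ᶠ proj₂ ab

InInterval : {n : ℕ} → Fin n → Interval n → Set
InInterval j ((a , b) , _) = (a ≤ᶠ j) × (j ≤ᶠ b)

IsUnionOf : {n : ℕ} → SubsetOf n → List (Interval n) → Set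
IsUnionOf S Is = ∀ j → (S j ≡ true) ⇔ Any (InInterval j) Is

UnionOfFewerIntervals : {n : ℕ} → ℕ → SubsetOf n → Set
UnionOfFewerIntervals {n} k S =
  ∃ λ (Is : List (Interval n)) → (length Is < k) × IsUnionOf S Is

-- Colour a word w by V(w) mod r, where V(w) is the sum of a weight t(x , y) over the pairs of
-- consecutive letters of 1 w₁ … wₙ 1.  The table t satisfies, at every pair of consecutive
-- positions of a line {w(S,1), w(S,2), w(S,3)}, the local identity
--   t(x₁ , y₁) + t(x₂ , y₂) = 2 t(x₃ , y₃) + 2 [the first position is in S and the second is not],
-- where (xᵢ , yᵢ) are the two letters of w(S,i).  Summing along the word,
--   V(w(S,1)) + V(w(S,2)) = 2 V(w(S,3)) + 2k,
-- where k is the number of maximal intervals of S.  On a monochromatic line this gives r ∣ 2k, so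
-- r ∣ k as r is odd; but 1 ≤ k < r when S is nonempty and a union of fewer than r intervals.
module Submission where

open import Defs
open import Algebra.Properties.CommutativeSemigroup using (interchange)
open import Data.Bool using (Bool; true; false; if_then_else_)
open import Data.Fin using (Fin; zero; suc; toℕ)
open import Data.Fin.Properties using (toℕ-fromℕ<)
open import Data.List using (List; _∷_; length; mapMaybe)
open import Data.List.Properties using (length-mapMaybe)
open import Data.List.Relation.Unary.Any using (Any; here; there)
import Data.List.Relation.Unary.Any as Any
open import Data.List.Relation.Unary.Any.Properties using (Any-⊎⁻; map⁺; mapMaybe⁺)
open import Data.Maybe using (Maybe; just; nothing)
import Data.Maybe.Relation.Unary.Any as Maybe
import Data.Nat as ℕ
open import Data.Nat using (ℕ; _<_; _≤_; _%_; _/_; _+_; _*_; z≤n; s≤s; z<s; NonZero; >-nonZero)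
open import Data.Nat.Coprimality using (Coprime; coprime-divisor)
open import Data.Nat.DivMod using (_mod_; m≡m%n+[m/n]*n)
open import Data.Nat.Divisibility using (_∣_; divides; ∣m+n∣m⇒∣n; n∣m*n; ∣⇒≤; 0∣⇒≡0; n∣m⇒m%n≡0; >⇒∤)
open import Data.Nat.Properties
  using (≤-trans; <-trans; +-identityʳ; +-monoʳ-≤; ≤-<-trans; m≤n+m; m<n⇒m<1+n; +-cancelˡ-≡; +-commutativeSemigroup)
open import Data.Nat.Tactic.RingSolver using (solve-∀)
open import Data.Product using (Σ; _,_)
open import Data.Sum using (_⊎_; inj₁; inj₂)
open import Data.Vec.Functional using (head; tail)
open import Function.Bundles using (Equivalence; mk⇔)
open import Relation.Nullary using (¬_; contradiction)
open import Relation.Binary.PropositionalEquality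
  using (_≡_; refl; sym; trans; cong; cong₂; subst; module ≡-Reasoning)

open Equivalence using (to; from)

∣-of-congruent-sum : ∀ r .{{_ : NonZero r}} {a b c d} →
  a % r ≡ c % r → b % r ≡ c % r → a + b ≡ c + c + d → r ∣ d
∣-of-congruent-sum r {a} {b} {c} {d} a≡c b≡c a+b≡c+c+d =
  ∣m+n∣m⇒∣n (divides (a / r + b / r) (sym (+-cancelˡ-≡ (m + m) _ _ sums))) (n∣m*n (c / r + c / r))
  where
  open ≡-Reasoning
  m = c % r
  split : ∀ x → x % r ≡ m → x ≡ m + (x / r) * r
  split x x≡c = trans (m≡m%n+[m/n]*n x r) (cong (_+ (x / r) * r) x≡c)
  regroup : ∀ m x y r → m + m + (x + y) * r ≡ (m + x * r) + (m + y * r)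
  regroup = solve-∀
  regroup′ : ∀ m z r d → (m + z * r) + (m + z * r) + d ≡ m + m + ((z + z) * r + d)
  regroup′ = solve-∀
  sums : m + m + (a / r + b / r) * r ≡ m + m + ((c / r + c / r) * r + d)
  sums = begin
    m + m + (a / r + b / r) * r                  ≡⟨ regroup m (a / r) (b / r) r ⟩
    (m + (a / r) * r) + (m + (b / r) * r)        ≡⟨ sym (cong₂ _+_ (split a a≡c) (split b b≡c)) ⟩
    a + b                                        ≡⟨ a+b≡c+c+d ⟩
    c + c + d                                    ≡⟨ cong (λ z → z + z + d) (split c refl) ⟩
    (m + (c / r) * r) + (m + (c / r) * r) + d    ≡⟨ regroup′ m (c / r) r d ⟩
    m + m + ((c / r + c / r) * r + d)            ∎

odd⇒coprime-2 : ∀ {r} → r % 2 ≡ 1 → Coprime r 2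
odd⇒coprime-2 {r} odd {d} (d∣r , d∣2) = only-1 d d∣r d∣2
  where
  only-1 : ∀ d → d ∣ r → d ∣ 2 → d ≡ 1
  only-1 0 _ 0∣2 = contradiction (0∣⇒≡0 0∣2) λ ()
  only-1 1 _ _ = refl
  only-1 2 2∣r _ = contradiction (trans (sym odd) (n∣m⇒m%n≡0 r 2 2∣r)) λ ()
  only-1 (ℕ.suc (ℕ.suc (ℕ.suc _))) _ d∣2 = contradiction (∣⇒≤ d∣2) λ { (s≤s (s≤s ())) }

mod-≡⇒%-≡ : ∀ {r} .{{_ : NonZero r}} {m k} → m mod r ≡ k mod r → m % r ≡ k % r
mod-≡⇒%-≡ eq = trans (sym (toℕ-fromℕ< _)) (trans (cong toℕ eq) (toℕ-fromℕ< _))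

module _ {A B : Set} (f : A → Maybe B) where

  mapMaybe⁻ : ∀ {P : B → Set} xs → Any P (mapMaybe f xs) → Any (λ x → Maybe.Any P (f x)) xs
  mapMaybe⁻ (x ∷ xs) p with f x in fx
  ... | nothing = there (mapMaybe⁻ xs p)
  mapMaybe⁻ (x ∷ xs) (here py) | just y = here (subst (Maybe.Any _) (sym fx) (Maybe.just py))
  mapMaybe⁻ (x ∷ xs) (there p) | just y = there (mapMaybe⁻ xs p)

  length-mapMaybe-< : ∀ xs → Any (λ x → f x ≡ nothing) xs → length (mapMaybe f xs) < length xs
  length-mapMaybe-< (x ∷ xs) (here fx≡nothing) rewrite fx≡nothing = s≤s (length-mapMaybe f xs)
  length-mapMaybe-< (x ∷ xs) (there p) with f x
  ... | nothing = m<n⇒m<1+n (length-mapMaybe-< xs p)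
  ... | just _ = s≤s (length-mapMaybe-< xs p)

-- A record, not a bare equation, so that v and k are inferred when instances are combined.
record LineIdentity (v : Fin 3 → ℕ) (k : ℕ) : Set where
  constructor lineIdentity
  field
    sum≡ : v zero + v (suc zero) ≡ v (suc (suc zero)) + v (suc (suc zero)) + 2 * k

LineIdentity-+ : ∀ {u v e f} → LineIdentity u e → LineIdentity v f →
  LineIdentity (λ i → u i + v i) (e + f)
LineIdentity-+ {u} {v} {e} {f} (lineIdentity u≡) (lineIdentity v≡) = lineIdentity (begin
  (u₀ + v₀) + (u₁ + v₁)                  ≡⟨ interchange +-commutativeSemigroup u₀ v₀ u₁ v₁ ⟩
  (u₀ + u₁) + (v₀ + v₁)                  ≡⟨ cong₂ _+_ u≡ v≡ ⟩
  (u₂ + u₂ + 2 * e) + (v₂ + v₂ + 2 * f)  ≡⟨ regroup u₂ v₂ e f ⟩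
  (u₂ + v₂) + (u₂ + v₂) + 2 * (e + f)    ∎)
  where
  open ≡-Reasoning
  u₀ = u zero; u₁ = u (suc zero); u₂ = u (suc (suc zero))
  v₀ = v zero; v₁ = v (suc zero); v₂ = v (suc (suc zero))
  regroup : ∀ a b e f → (a + a + 2 * e) + (b + b + 2 * f) ≡ (a + b) + (a + b) + 2 * (e + f)
  regroup = solve-∀

transitionWeight : Fin 3 → Fin 3 → ℕ
transitionWeight zero zero = 0
transitionWeight zero (suc zero) = 2
transitionWeight zero (suc (suc zero)) = 1
transitionWeight (suc zero) zero = 2
transitionWeight (suc zero) (suc zero) = 0
transitionWeight (suc zero) (suc (suc zero)) = 1
transitionWeight (suc (suc zero)) _ = 0

walkWeight : ∀ {n} → Fin 3 → Word n → ℕ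
walkWeight {0} p w = transitionWeight p zero
walkWeight {ℕ.suc n} p w = transitionWeight p (head w) + walkWeight (head w) (tail w)

-- replace w S i j unfolds to lineLetter (S j) (w j) i.
lineLetter : Bool → Fin 3 → Fin 3 → Fin 3
lineLetter b x i = if b then i else x

isBlockEnd : Bool → Bool → ℕ
isBlockEnd true false = 1
isBlockEnd _ _ = 0

transitionWeight-line : ∀ b c x y →
  LineIdentity (λ i → transitionWeight (lineLetter b x i) (lineLetter c y i)) (isBlockEnd b c)
transitionWeight-line true true x y = lineIdentity refl
transitionWeight-line true false x zero = lineIdentity refl
transitionWeight-line true false x (suc zero) = lineIdentity refl
transitionWeight-line true false x (suc (suc zero)) = lineIdentity refl
transitionWeight-line false true zero y = lineIdentity refl
transitionWeight-line false true (suc zero) y = lineIdentity refl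
transitionWeight-line false true (suc (suc zero)) y = lineIdentity refl
transitionWeight-line false false x y = lineIdentity (sym (+-identityʳ _))

headBit : ∀ {n} → SubsetOf n → Bool
headBit {0} S = false
headBit {ℕ.suc n} S = head S

blockCount : ∀ {n} → SubsetOf n → ℕ
blockCount {0} S = 0
blockCount {ℕ.suc n} S = isBlockEnd (head S) (headBit (tail S)) + blockCount (tail S)

-- b records whether the position before the word lies in S.
walkWeight-line : ∀ {n} b x (w : Word n) (S : SubsetOf n) →
  LineIdentity (λ i → walkWeight (lineLetter b x i) (replace w S i))
               (isBlockEnd b (headBit S) + blockCount S)
walkWeight-line {0} b x w S rewrite +-identityʳ (isBlockEnd b false) =
  transitionWeight-line b false x zero
walkWeight-line {ℕ.suc n} b x w S =
  LineIdentity-+ (transitionWeight-line b (head S) x (head w))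
                 (walkWeight-line (head S) (head w) (tail w) (tail S))

headBit-nonEmpty : ∀ {n} {S : SubsetOf n} → headBit S ≡ true → NonEmpty S
headBit-nonEmpty {0} ()
headBit-nonEmpty {ℕ.suc n} S₀ = zero , S₀

blockCount-pos : ∀ {n} (S : SubsetOf n) → NonEmpty S → 0 < blockCount S
blockCount-pos {ℕ.suc n} S (suc j , Sj) = ≤-trans (blockCount-pos (tail S) (j , Sj)) (m≤n+m _ _)
blockCount-pos {ℕ.suc n} S (zero , S₀) with headBit (tail S) in S₁
... | true = ≤-trans (blockCount-pos (tail S) (headBit-nonEmpty S₁)) (m≤n+m _ _)
... | false rewrite S₀ = s≤s z≤n

right : ∀ {n} → Interval n → Fin n
right ((_ , b) , _) = b

tailInterval : ∀ {n} → Interval (ℕ.suc n) → Maybe (Interval n)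
tailInterval ((zero , zero) , _) = nothing
tailInterval {ℕ.suc n} ((zero , suc b) , _) = just ((zero , b) , z≤n)
tailInterval ((suc a , suc b) , s≤s a≤b) = just ((a , b) , a≤b)

tailInterval⁺ : ∀ {n} {j : Fin n} (I : Interval (ℕ.suc n)) →
  InInterval (suc j) I → Maybe.Any (InInterval j) (tailInterval I)
tailInterval⁺ ((zero , zero) , _) (_ , ())
tailInterval⁺ {ℕ.suc n} ((zero , suc b) , _) (_ , s≤s j≤b) = Maybe.just (z≤n , j≤b)
tailInterval⁺ ((suc a , suc b) , s≤s _) (s≤s a≤j , s≤s j≤b) = Maybe.just (a≤j , j≤b)

tailInterval⁻ : ∀ {n} {j : Fin n} (I : Interval (ℕ.suc n)) →
  Maybe.Any (InInterval j) (tailInterval I) → InInterval (suc j) I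
tailInterval⁻ ((zero , zero) , _) ()
tailInterval⁻ {ℕ.suc n} ((zero , suc b) , _) (Maybe.just (_ , j≤b)) = z≤n , s≤s j≤b
tailInterval⁻ ((suc a , suc b) , s≤s _) (Maybe.just (a≤j , j≤b)) = s≤s a≤j , s≤s j≤b

tailInterval-right≡0 : ∀ {n} (I : Interval (ℕ.suc n)) → right I ≡ zero → tailInterval I ≡ nothing
tailInterval-right≡0 ((zero , zero) , _) refl = refl

covers-0⇒right≡0-or-covers-1 : ∀ {n} (I : Interval (ℕ.suc (ℕ.suc n))) →
  InInterval zero I → right I ≡ zero ⊎ InInterval (suc zero) I
covers-0⇒right≡0-or-covers-1 ((_ , zero) , _) _ = inj₁ refl
covers-0⇒right≡0-or-covers-1 ((_ , suc _) , _) (a≤0 , _) = inj₂ (≤-trans a≤0 z≤n , s≤s z≤n)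

right-Fin1≡0 : (I : Interval 1) → right I ≡ zero
right-Fin1≡0 ((_ , zero) , _) = refl

tailIntervals : ∀ {n} → List (Interval (ℕ.suc n)) → List (Interval n)
tailIntervals = mapMaybe tailInterval

IsUnionOf-tail : ∀ {n} {S : SubsetOf (ℕ.suc n)} {Is} →
  IsUnionOf S Is → IsUnionOf (tail S) (tailIntervals Is)
IsUnionOf-tail {Is = Is} S≡⋃Is j = mk⇔
  (λ Sj → mapMaybe⁺ tailInterval Is (map⁺ (Any.map (tailInterval⁺ _) (to (S≡⋃Is (suc j)) Sj))))
  (λ p → from (S≡⋃Is (suc j)) (Any.map (tailInterval⁻ _) (mapMaybe⁻ tailInterval Is p)))

blockEnd-0⇒interval : ∀ {n} {S : SubsetOf (ℕ.suc n)} {Is} → IsUnionOf S Is →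
  head S ≡ true → headBit (tail S) ≡ false → Any (λ I → right I ≡ zero) Is
blockEnd-0⇒interval {0} S≡⋃Is S₀ _ = Any.map (λ {I} _ → right-Fin1≡0 I) (to (S≡⋃Is zero) S₀)
blockEnd-0⇒interval {ℕ.suc n} S≡⋃Is S₀ S₁
  with Any-⊎⁻ (Any.map (λ {I} → covers-0⇒right≡0-or-covers-1 I) (to (S≡⋃Is zero) S₀))
... | inj₁ ends-at-0 = ends-at-0
... | inj₂ covers-1 = contradiction (trans (sym S₁) (from (S≡⋃Is (suc zero)) covers-1)) λ ()

isBlockEnd-+-≤ : ∀ b c {m k} → m ≤ k → (b ≡ true → c ≡ false → m < k) → isBlockEnd b c + m ≤ k
isBlockEnd-+-≤ true false _ m<k = m<k refl refl
isBlockEnd-+-≤ true true m≤k _ = m≤k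
isBlockEnd-+-≤ false _ m≤k _ = m≤k

-- Passing to the tail discards exactly the intervals {0}, and a block ending at 0 forces one of them.
blockCount-≤-length : ∀ {n} {S : SubsetOf n} {Is} → IsUnionOf S Is → blockCount S ≤ length Is
blockCount-≤-length {0} _ = z≤n
blockCount-≤-length {ℕ.suc n} {S} {Is} S≡⋃Is =
  ≤-trans (+-monoʳ-≤ (isBlockEnd (head S) (headBit (tail S))) (blockCount-≤-length (IsUnionOf-tail S≡⋃Is)))
          (isBlockEnd-+-≤ (head S) (headBit (tail S)) (length-mapMaybe tailInterval Is)
             λ S₀ S₁ → length-mapMaybe-< tailInterval Is
                         (Any.map (tailInterval-right≡0 _) (blockEnd-0⇒interval S≡⋃Is S₀ S₁)))

mainTheorem1 : (n r : ℕ) → 1 < r → r % 2 ≡ 1 →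
    Σ (Colouring r n) λ c →
      (w : Word n) (S : SubsetOf n) →
        MonochromaticLine c w S → ¬ UnionOfFewerIntervals r S
mainTheorem1 n r 1<r r-odd = colouring , no-monochromatic-line
  where
  instance
    r≢0 : NonZero r
    r≢0 = >-nonZero (<-trans z<s 1<r)

  colouring : Colouring r n
  colouring w = walkWeight zero w mod r

  no-monochromatic-line : (w : Word n) (S : SubsetOf n) →
    MonochromaticLine colouring w S → ¬ UnionOfFewerIntervals r S
  no-monochromatic-line w S (S≢∅ , c₀≡c₁ , c₁≡c₂) (Is , |Is|<r , S≡⋃Is) =
    >⇒∤ k<r (coprime-divisor (odd⇒coprime-2 r-odd) r∣2k)
    where
    k = blockCount S
    instance
      k≢0 : NonZero k
      k≢0 = >-nonZero (blockCount-pos S S≢∅)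
    k<r : k < r
    k<r = ≤-<-trans (blockCount-≤-length S≡⋃Is) |Is|<r
    r∣2k : r ∣ 2 * k
    r∣2k = ∣-of-congruent-sum r (mod-≡⇒%-≡ (trans c₀≡c₁ c₁≡c₂)) (mod-≡⇒%-≡ c₁≡c₂)
                                (LineIdentity.sum≡ (walkWeight-line false zero w S))
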